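{- Let $\Psi = \Pi:\varphi\land C$ be a DQBF with a clause $C$, let $C'\subsetneq C$, and let $V'=\mathrm{dep}(C')$. (1) If $\mathrm{abs}(\Pi:\varphi\land \neg C', V')\vdash_{1\forall}\bot$, then $\Psi\equiv \Pi:\varphi\land C'$. (2) If $\mathrm{abs}(\Pi:\varphi\land\neg C', V')\vdash_{1\forall}U$ with $\ell\in U\cap(C\setminus C')$, then $\Psi\equiv\Pi:\varphi\land(C'\cup\{\ell\})$.
   Context: A DQBF over a finite set $V=\{x_1,\dots,x_n,y_1,\dots,y_m\}$ of Boolean variables has the form $\forall x_1\ldots\forall x_n\exists y_1(D_{y_1})\ldots\exists y_m(D_{y_m}):\varphi$, where $D_{y_i}\subseteq\{x_1,\dots,x_n\}$ is the dependency set of $y_i$ and the matrix $\varphi$ is a CNF over $V$, treated as a set of clauses, each clause a set of literals. The prefix is treated as a set $\Pi$ and the DQBF is written $\Pi:\varphi$. $V_\exists$ and $V_\forall$ denote the existential and universal variables. For a set $X$ of variables, $\mathcal{A}(X)$ is the set of assignments $X\to\{0,1\}$. A Skolem function for a DQBF is a family $(s_y)_{y\in V_\exists}$ with $s_y:\mathcal{A}(D_y)\to\{0,1\}$ such that replacing every $y$ by $s_y$ turns $\varphi$ into a tautology. Two DQBFs over the same existential and universal variables are equivalent ($\equiv$) iff they have exactly the same Skolem functions. Dependencies are defined by $\mathrm{dep}(v)=\{v\}$ if $v$ is universal and $\mathrm{dep}(v)=D_v$ if $v$ is existential. For a literal, $\mathrm{dep}(\ell)=\mathrm{dep}(\mathrm{var}(\ell))$;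 for a clause, $\mathrm{dep}(C)=\bigcup_{\ell\in C}\mathrm{dep}(\ell)$. $\Pi:\varphi\land C$ denotes $\Pi:\varphi\cup\{C\}$. $\Pi:\varphi\land\neg C'$ denotes $\varphi$ together with the unit clauses $\{\neg k\}$ for all $k\in C'$. Abstraction: for $V'\subseteq V_\forall$, $\mathrm{abs}(\Pi:\varphi,V')$ is the DQBF with the same matrix in which each $v\in V'$ is removed as a universal variable, removed from all dependency sets, and instead quantified as $\exists v(\emptyset)$. Universal reduction: for a non-tautological clause $C$, $\mathrm{UR}(C)$ removes from $C$ every universal literal $\ell$ for which no existential literal $k\in C$ has $\mathrm{var}(\ell)\in D_{\mathrm{var}(k)}$. Also $\mathrm{UR}(\Pi:\varphi)=\Pi:\{\mathrm{UR}(C)\mid C\in\varphi\}$. Unit propagation: let $U_0$ be the set of literals $\ell$ with $\{\ell\}\in\varphi$ and $\mathrm{var}(\ell)$ existential. Define $\mathrm{UP}^1(\Pi:\varphi)=\mathrm{UR}\bigl(\Pi\setminus\{\mathrm{var}(\ell)\mid\ell\in U_0\}:\{C\setminus\{\neg\ell\mid\ell\in U_0\}\mid C\in\varphi,\ C\cap U_0=\emptyset\}\bigr)$. Iterate to a fixpoint $\mathrm{UP}(\Pi:\varphi)$. Write $\Pi:\varphi\vdash_{1\forall}\bot$ if the empty clause is in $\mathrm{UP}(\Pi:\varphi)$. Otherwise write $\Pi:\varphi\vdash_{1\forall}U$, where $U$ is the set of all unit literals processed in all rounds. -}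

module Defs where

open import Data.Nat using (ℕ; zero; suc)
open import Data.Nat.Properties using (_≟_)
open import Data.Bool using (Bool; true; false; not; _∧_; _∨_; if_then_else_)
open import Data.Bool.Properties using () renaming (_≟_ to _≟ᵇ_)
open import Data.Product using (_×_; _,_; proj₁; proj₂; ∃)
open import Data.List using (List; []; _∷_; _++_; map; filterᵇ; concatMap)
open import Data.Bool.ListAction using (any)
open import Data.List.Membership.Propositional using (_∈_; _∉_)
open import Data.List.Relation.Unary.All using (All)
open import Data.List.Relation.Unary.Any using (Any)
open import Data.List.Relation.Unary.Unique.Propositional using (Unique)
open import Data.Maybe using (Maybe; just; nothing; is-just; fromMaybe)
open import Relation.Nullary using (¬_; does)
open import Relation.Binary.PropositionalEquality using (_≡_)
open import Function.Bundles using (_⇔_)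

Var : Set
Var = ℕ

-- A literal (b , v): b = true means the positive literal v, b = false means ¬v.
Literal : Set
Literal = Bool × Var

var : Literal → Var
var = proj₂

neg : Literal → Literal
neg (b , v) = (not b , v)

-- Clauses and CNFs are finite lists, read as sets (only membership matters).
Clause : Set
Clause = List Literal

CNF : Set
CNF = List Clause

record Prefix : Set where
  constructor mkPrefix
  field
    univ  : List Var
    exist : List (Var × List Var)
open Prefix public

memV : Var → List Var → Bool
memV v xs = any (λ w → does (v ≟ w)) xs

litEq : Literal → Literal → Bool
litEq (b , v) (c , w) = does (b ≟ᵇ c) ∧ does (v ≟ w)

memL : Literal → Clause → Bool
memL l C = any (litEq l) C

lookupDeps : List (Var × List Var) → Var → Maybe (List Var)
lookupDeps [] v = nothing
lookupDeps ((y , D) ∷ ys) v = if does (v ≟ y) then just D else lookupDeps ys v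

isUniv : Prefix → Var → Bool
isUniv P v = memV v (univ P)

isExist : Prefix → Var → Bool
isExist P v = is-just (lookupDeps (exist P) v)

-- D_y for an existential y (empty list for non-existential variables)
depsOf : Prefix → Var → List Var
depsOf P v = fromMaybe [] (lookupDeps (exist P) v)

dep : Prefix → Var → List Var
dep P v = if isExist P v then depsOf P v else (if isUniv P v then v ∷ [] else [])

depClause : Prefix → Clause → List Var
depClause P C = concatMap (λ l → dep P (var l)) C

andClause : CNF → Clause → CNF
andClause φ C = C ∷ φ

andNegClause : CNF → Clause → CNF
andNegClause φ C' = map (λ k → neg k ∷ []) C' ++ φ

-- Abstraction abs(Π, V'): every v ∈ V' becomes ∃v(∅), and is removed from
-- the universals and from all dependency sets.  (The matrix is unchanged.)

absPrefix : Prefix → List Var → Prefix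
absPrefix P V' =
  mkPrefix (filterᵇ (λ x → not (memV x V')) (univ P))
           (map (λ v → (v , [])) V'
             ++ map (λ yD → (proj₁ yD , filterᵇ (λ x → not (memV x V')) (proj₂ yD))) (exist P))

tautological : Clause → Bool
tautological C = any (λ l → memL (neg l) C) C

urKeep : Prefix → Clause → Literal → Bool
urKeep P C l =
  not (isUniv P (var l)) ∨ any (λ k → isExist P (var k) ∧ memV (var l) (depsOf P (var k))) C

-- UR is only defined for non-tautological clauses; tautological clauses are
-- left unchanged (convention).
URclause : Prefix → Clause → Clause
URclause P C = if tautological C then C else filterᵇ (urKeep P C) C

UR : Prefix → CNF → CNF
UR P φ = map (URclause P) φ

unitOf : Prefix → Clause → List Literal
unitOf P (l ∷ []) = if isExist P (var l) then l ∷ [] else []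
unitOf P _        = []

unitLits : Prefix → CNF → List Literal
unitLits P φ = concatMap (unitOf P) φ

UP1 : Prefix → CNF → CNF
UP1 P φ =
  UR P (map (filterᵇ (λ l → not (memL l (map neg U₀))))
            (filterᵇ (λ C → not (any (λ l → memL l U₀) C)) φ))
  where U₀ = unitLits P φ

UPiter : Prefix → ℕ → CNF → CNF
UPiter P zero    φ = φ
UPiter P (suc k) φ = UP1 P (UPiter P k φ)

UPunits : Prefix → ℕ → CNF → List Literal
UPunits P zero    φ = []
UPunits P (suc k) φ = UPunits P k φ ++ unitLits P (UPiter P k φ)

IsFixRound : Prefix → ℕ → CNF → Set
IsFixRound P k φ = UP1 P (UPiter P k φ) ≡ UPiter P k φ

_⊢1∀⊥ : Prefix × CNF → Set
(P , φ) ⊢1∀⊥ = ∃ λ k → IsFixRound P k φ × ([] ∈ UPiter P k φ)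

_⊢1∀_ : Prefix × CNF → List Literal → Set
(P , φ) ⊢1∀ U =
  ∃ λ k → IsFixRound P k φ × ([] ∉ UPiter P k φ) × (U ≡ UPunits P k φ)

-- A candidate Skolem family: s y α is the value of y under the universal
-- assignment α : Var → Bool.
SkolemCandidate : Set
SkolemCandidate = Var → (Var → Bool) → Bool

RespectsDeps : Prefix → SkolemCandidate → Set
RespectsDeps P s =
  All (λ yD → ∀ (α β : Var → Bool) → (∀ x → x ∈ proj₂ yD → α x ≡ β x) →
              s (proj₁ yD) α ≡ s (proj₁ yD) β) (exist P)

value : Prefix → (Var → Bool) → SkolemCandidate → Var → Bool
value P α s v = if isExist P v then s v α else α v

IsSkolem : Prefix → CNF → SkolemCandidate → Set
IsSkolem P φ s =
  ∀ (α : Var → Bool) → All (λ C → Any (λ l → value P α s (var l) ≡ proj₁ l) C) φ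

_≡DQBF_ : Prefix × CNF → Prefix × CNF → Set
(P , φ) ≡DQBF (Q , ψ) =
  ∀ (s : SkolemCandidate) → RespectsDeps P s → RespectsDeps Q s →
    (IsSkolem P φ s ⇔ IsSkolem Q ψ s)

WellFormed : Prefix → CNF → Set
WellFormed P φ =
  Unique (univ P) ×
  Unique (map proj₁ (exist P)) ×
  (∀ v → v ∈ univ P → v ∉ map proj₁ (exist P)) ×
  All (λ yD → ∀ x → x ∈ proj₂ yD → x ∈ univ P) (exist P) ×
  All (λ C → All (λ l → var l ∈ univ P ⊎' var l ∈ map proj₁ (exist P)) C) φ
  where
    open import Data.Sum using () renaming (_⊎_ to _⊎'_)

_⊂_ : Clause → Clause → Set
C' ⊂ C = (∀ l → l ∈ C' → l ∈ C) × ∃ λ l → l ∈ C × l ∉ C'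

{-# OPTIONS --safe #-}
module Submission where

-- Let s be a Skolem function of Π : φ and α a universal assignment at which s falsifies C'.
-- Fixing the universals V' = dep(C') to their values under α turns s into a Skolem function
-- of abs(Π : φ ∧ ¬C', V'), in which they have become constants; the unit clauses ¬C' hold
-- because C' only depends on V'. Universal reduction and unit propagation are sound for
-- Skolem functions, so on the abstraction they derive neither the empty clause nor a false
-- unit literal. Hence in case (1) every Skolem function of φ satisfies C' everywhere, and in
-- case (2) it satisfies ℓ wherever it falsifies C'. Replacing C by a subclause that every
-- Skolem function of φ satisfies does not change the set of Skolem functions.

open import Defs
open import Data.Bool using (Bool; true; false; not; T; T?; if_then_else_; _∧_; _∨_)
open import Data.Bool.Properties using (_≟_; T-≡; ¬-not; not-¬; not-injective; ∨-conicalˡ; ∨-conicalʳ)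
open import Data.Bool.ListAction using (any)
open import Data.Empty using (⊥-elim)
open import Data.List using (List; []; _∷_; _++_; map; filterᵇ)
open import Data.List.Membership.Propositional using (_∈_; _∉_; find; lose)
open import Data.List.Membership.Propositional.Properties
  using (∈-map⁺; ∈-map⁻; ∈-filter⁺; ∈-filter⁻; ∈-concatMap⁺; ∈-concatMap⁻; ∈-++⁻)
open import Data.List.Relation.Binary.Subset.Propositional using (_⊆_)
open import Data.List.Relation.Binary.Subset.Propositional.Properties using (Any-resp-⊆)
open import Data.List.Relation.Unary.All as All using (All; _∷_)
import Data.List.Relation.Unary.All.Properties as All
open import Data.List.Relation.Unary.Any as Any using (Any; here; there)
open import Data.List.Relation.Unary.Any.Properties using (any⁺; any⁻)
import Data.Maybe as Maybe
open import Data.Maybe using (just; nothing; is-just)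
open import Data.Nat using (zero; suc; _≡ᵇ_)
open import Data.Nat.Properties using (≡ᵇ⇒≡; ≡⇒≡ᵇ)
open import Data.Product using (_×_; _,_; proj₁; proj₂; map₂)
open import Data.Sum using (_⊎_; inj₁; inj₂; [_,_]′)
open import Function.Base using (_∘_; id)
open import Function.Bundles using (_⇔_; mk⇔; Equivalence)
open import Relation.Binary.PropositionalEquality
  using (_≡_; refl; sym; trans; cong; cong₂; subst; module ≡-Reasoning)
open import Relation.Nullary using (¬_)
open import Relation.Nullary.Decidable using (yes; no)

private variable
  A : Set

any-≡⇔∈ : {p : A → Bool} {x : A} → (∀ {y} → T (p y) ⇔ x ≡ y) →
          ∀ xs → any p xs ≡ true ⇔ x ∈ xs
any-≡⇔∈ p⇔ xs = mk⇔
  (λ e → Any.map (Equivalence.to p⇔) (any⁻ _ xs (Equivalence.from T-≡ e)))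
  (λ x∈ → Equivalence.to T-≡ (any⁺ _ (Any.map (Equivalence.from p⇔) x∈)))

memV⇔∈ : ∀ {v xs} → memV v xs ≡ true ⇔ v ∈ xs
memV⇔∈ {v} = any-≡⇔∈ (λ {w} → mk⇔ (≡ᵇ⇒≡ v w) (≡⇒≡ᵇ v w)) _

litEq⇔≡ : ∀ {l k} → T (litEq l k) ⇔ l ≡ k
litEq⇔≡ {b , v} {c , w} with b ≟ c
... | yes refl = mk⇔ (cong (b ,_) ∘ ≡ᵇ⇒≡ v w) λ { refl → ≡⇒≡ᵇ v v refl }
... | no b≢c   = mk⇔ (λ ()) λ { refl → b≢c refl }

memL⇔∈ : ∀ {l C} → memL l C ≡ true ⇔ l ∈ C
memL⇔∈ = any-≡⇔∈ litEq⇔≡ _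

∈⇒any : ∀ {p : A → Bool} {x xs} → x ∈ xs → p x ≡ true → any p xs ≡ true
∈⇒any x∈ px = Equivalence.to T-≡ (any⁺ _ (Any.map (λ { refl → Equivalence.from T-≡ px }) x∈))

∈-filterᵇ⁺ : ∀ {p : A → Bool} {x xs} → x ∈ xs → p x ≡ true → x ∈ filterᵇ p xs
∈-filterᵇ⁺ {p = p} x∈ px = ∈-filter⁺ (T? ∘ p) x∈ (Equivalence.from T-≡ px)

∈-filterᵇ⁻ : ∀ {p : A → Bool} {x} xs → x ∈ filterᵇ p xs → x ∈ xs × p x ≡ true
∈-filterᵇ⁻ {p = p} xs x∈ = map₂ (Equivalence.to T-≡) (∈-filter⁻ (T? ∘ p) {xs = xs} x∈)

¬tautological⇒neg∉ : ∀ {C l} → tautological C ≡ false → l ∈ C → neg l ∉ C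
¬tautological⇒neg∉ taut l∈ nl∈ = not-¬ (∈⇒any l∈ (Equivalence.from memL⇔∈ nl∈)) taut

lookupDeps-just⇒∈ : ∀ L {v D} → lookupDeps L v ≡ just D → (v , D) ∈ L
lookupDeps-just⇒∈ ((y , D) ∷ L) {v} e with v ≡ᵇ y in v≡ᵇy
... | true with refl ← e | refl ← ≡ᵇ⇒≡ v y (Equivalence.from T-≡ v≡ᵇy) = here refl
... | false = there (lookupDeps-just⇒∈ L e)

∈-keys⇒lookupDeps-is-just : ∀ L {v} → v ∈ map proj₁ L → is-just (lookupDeps L v) ≡ true
∈-keys⇒lookupDeps-is-just ((y , D) ∷ L) {v} v∈ with v ≡ᵇ y in v≡ᵇy | v∈
... | true  | _          = refl
... | false | here refl  = ⊥-elim (subst T v≡ᵇy (≡⇒≡ᵇ v v refl))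
... | false | there v∈L = ∈-keys⇒lookupDeps-is-just L v∈L

lookupDeps-constants : ∀ W L v →
  lookupDeps (map (λ w → (w , [])) W ++ L) v ≡ (if memV v W then just [] else lookupDeps L v)
lookupDeps-constants []      L v = refl
lookupDeps-constants (w ∷ W) L v with v ≡ᵇ w
... | true  = refl
... | false = lookupDeps-constants W L v

lookupDeps-mapDeps : ∀ (f : List Var → List Var) L v →
  lookupDeps (map (λ yD → (proj₁ yD , f (proj₂ yD))) L) v ≡ Maybe.map f (lookupDeps L v)
lookupDeps-mapDeps f []            v = refl
lookupDeps-mapDeps f ((y , D) ∷ L) v with v ≡ᵇ y
... | true  = refl
... | false = lookupDeps-mapDeps f L v

existVars : Prefix → List Var
existVars P = map proj₁ (exist P)

QuantifiersDisjoint : Prefix → Set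
QuantifiersDisjoint P = ∀ v → v ∈ univ P → v ∉ existVars P

DepsUniversal : Prefix → Set
DepsUniversal P = All (λ yD → ∀ x → x ∈ proj₂ yD → x ∈ univ P) (exist P)

isExist⇒∈existVars : ∀ P {v} → isExist P v ≡ true → v ∈ existVars P
isExist⇒∈existVars P {v} e with lookupDeps (exist P) v in eq | e
... | just D  | _ = ∈-map⁺ proj₁ (lookupDeps-just⇒∈ (exist P) eq)
... | nothing | ()

∈existVars⇒isExist : ∀ P {v} → v ∈ existVars P → isExist P v ≡ true
∈existVars⇒isExist P = ∈-keys⇒lookupDeps-is-just (exist P)

∈univ⇒¬isExist : ∀ {P} → QuantifiersDisjoint P → ∀ {v} → v ∈ univ P → isExist P v ≡ false
∈univ⇒¬isExist {P} disj v∈ = ¬-not λ e → disj _ v∈ (isExist⇒∈existVars P e)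

∈-depsOf⇒isExist : ∀ P {v x} → x ∈ depsOf P v → isExist P v ≡ true
∈-depsOf⇒isExist P {v} x∈ with lookupDeps (exist P) v | x∈
... | just D  | _ = refl
... | nothing | ()

depsOf⊆dep : ∀ P {v} → depsOf P v ⊆ dep P v
depsOf⊆dep P x∈ rewrite ∈-depsOf⇒isExist P x∈ = x∈

univ∈dep : ∀ P {v} → isExist P v ≡ false → isUniv P v ≡ true → v ∈ dep P v
univ∈dep P ¬ex isU rewrite ¬ex | isU = here refl

dep⊆univ : ∀ P → DepsUniversal P → ∀ v → dep P v ⊆ univ P
dep⊆univ P deps⊆univ v {x} x∈ with lookupDeps (exist P) v in eq
... | just D = All.lookup deps⊆univ (lookupDeps-just⇒∈ (exist P) eq) x x∈
... | nothing with isUniv P v in isU | x∈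
...   | true | here refl = Equivalence.to memV⇔∈ isU

depClause⊆univ : ∀ P → DepsUniversal P → ∀ C → depClause P C ⊆ univ P
depClause⊆univ P deps⊆univ C x∈ with find (∈-concatMap⁻ (λ l → dep P (var l)) {xs = C} x∈)
... | l , _ , x∈dep = dep⊆univ P deps⊆univ (var l) x∈dep

isExist-absPrefix : ∀ P V' v → isExist (absPrefix P V') v ≡ (memV v V' ∨ isExist P v)
isExist-absPrefix P V' v
  rewrite lookupDeps-constants V'
            (map (λ yD → (proj₁ yD , filterᵇ (λ x → not (memV x V')) (proj₂ yD))) (exist P)) v
  with memV v V'
... | true  = refl
... | false rewrite lookupDeps-mapDeps (filterᵇ (λ x → not (memV x V'))) (exist P) v
              with lookupDeps (exist P) v
...   | just _  = refl
...   | nothing = refl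

isExist-absPrefix-inside : ∀ P {V' v} → memV v V' ≡ true → isExist (absPrefix P V') v ≡ true
isExist-absPrefix-inside P {V'} {v} inV' = trans (isExist-absPrefix P V' v) (cong (_∨ isExist P v) inV')

isExist-absPrefix-outside : ∀ P {V' v} → memV v V' ≡ false → isExist (absPrefix P V') v ≡ isExist P v
isExist-absPrefix-outside P {V'} {v} outV' = trans (isExist-absPrefix P V' v) (cong (_∨ isExist P v) outV')

Satisfies : Prefix → SkolemCandidate → (Var → Bool) → Clause → Set
Satisfies P s α C = Any (λ l → value P α s (var l) ≡ proj₁ l) C

Entails : Prefix → CNF → Clause → Set
Entails P φ D = ∀ s → RespectsDeps P s → IsSkolem P φ s → ∀ α → Satisfies P s α D

value-nonExist : ∀ P {s α v} → isExist P v ≡ false → value P α s v ≡ α v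
value-nonExist P ¬ex rewrite ¬ex = refl

value-cong : ∀ P {s α β} v → RespectsDeps P s →
  (∀ x → x ∈ depsOf P v → α x ≡ β x) → (isExist P v ≡ false → α v ≡ β v) →
  value P α s v ≡ value P β s v
value-cong P v resp on-deps on-v with lookupDeps (exist P) v in eq
... | just D  = All.lookup resp (lookupDeps-just⇒∈ (exist P) eq) _ _ on-deps
... | nothing = on-v refl

entailed-subclause-≡DQBF : ∀ {P φ C D} → D ⊆ C → Entails P φ D →
                           (P , andClause φ C) ≡DQBF (P , andClause φ D)
entailed-subclause-≡DQBF D⊆C entailed s resp _ = mk⇔
  (λ sk α → entailed s resp (All.tail ∘ sk) α ∷ All.tail (sk α))
  (λ sk α → Any-resp-⊆ D⊆C (All.head (sk α)) ∷ All.tail (sk α))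

module PropagationSoundness (P : Prefix) (t : SkolemCandidate)
                            (disj : QuantifiersDisjoint P) (resp : RespectsDeps P t) where

  Valid : Clause → Set
  Valid C = ∀ α → Satisfies P t α C

  Forced : Literal → Set
  Forced l = ∀ α → value P α t (var l) ≡ proj₁ l

  module _ (C : Clause) where

    reduced : Clause
    reduced = filterᵇ (λ l → not (urKeep P C l)) C

    -- Universal reduction is sound: starting from α, make every reduced literal false. No kept
    -- literal depends on the changed variables, so whichever literal now satisfies C is kept
    -- and already satisfied C under α.
    falsifyReduced : (Var → Bool) → Var → Bool
    falsifyReduced α x = if memV x (map var reduced) then memL (false , x) reduced else α x

    ∈-reduced⁺ : ∀ {l} → l ∈ C → urKeep P C l ≡ false → l ∈ reduced
    ∈-reduced⁺ l∈ drop = ∈-filterᵇ⁺ l∈ (cong not drop)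

    ∈-reduced⁻ : ∀ {l} → l ∈ reduced → l ∈ C × urKeep P C l ≡ false
    ∈-reduced⁻ l∈ = map₂ not-injective (∈-filterᵇ⁻ C l∈)

    reduced-isUniv : ∀ {l} → urKeep P C l ≡ false → isUniv P (var l) ≡ true
    reduced-isUniv {l} drop = not-injective (∨-conicalˡ (not (isUniv P (var l))) _ drop)

    reduced-independent : ∀ {l k} → urKeep P C l ≡ false → k ∈ C → var l ∉ depsOf P (var k)
    reduced-independent {l} drop k∈ l∈deps = not-¬
      (∈⇒any k∈ (cong₂ _∧_ (∈-depsOf⇒isExist P l∈deps) (Equivalence.from memV⇔∈ l∈deps)))
      (∨-conicalʳ (not (isUniv P (var l))) _ drop)

    falsifyReduced-reduced : tautological C ≡ false → ∀ {α l} → l ∈ C → urKeep P C l ≡ false →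
      falsifyReduced α (var l) ≡ not (proj₁ l)
    falsifyReduced-reduced taut {l = b , v} l∈ drop
      rewrite Equivalence.from memV⇔∈ (∈-map⁺ var (∈-reduced⁺ l∈ drop)) = sign b l∈
      where
        sign : ∀ b → (b , v) ∈ C → memL (false , v) reduced ≡ not b
        sign false l∈ = Equivalence.from memL⇔∈ (∈-reduced⁺ l∈ drop)
        sign true  l∈ = ¬-not λ e →
          ¬tautological⇒neg∉ taut l∈ (proj₁ (∈-reduced⁻ (Equivalence.to memL⇔∈ e)))

    falsifyReduced-unreduced : ∀ {α x} → x ∉ map var reduced → falsifyReduced α x ≡ α x
    falsifyReduced-unreduced {x = x} x∉
      rewrite ¬-not {memV x (map var reduced)} (x∉ ∘ Equivalence.to memV⇔∈) = refl

    kept-unreduced : ∀ {l} → urKeep P C l ≡ true → var l ∉ map var reduced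
    kept-unreduced keep v∈ with ∈-map⁻ var v∈
    ... | r , r∈ , refl = not-¬ keep (proj₂ (∈-reduced⁻ r∈))

    deps-unreduced : ∀ {k x} → k ∈ C → x ∈ depsOf P (var k) → x ∉ map var reduced
    deps-unreduced {x = x} k∈ x∈ v∈ with ∈-map⁻ var v∈
    ... | r , r∈ , refl = reduced-independent {r} (proj₂ (∈-reduced⁻ r∈)) k∈ x∈

    falsifyReduced-preserves-kept : ∀ {α l} → l ∈ C → urKeep P C l ≡ true →
      value P (falsifyReduced α) t (var l) ≡ value P α t (var l)
    falsifyReduced-preserves-kept {α} {l} l∈ keep = value-cong P (var l) resp
      (λ x x∈ → falsifyReduced-unreduced {α} (deps-unreduced l∈ x∈))
      (λ _ → falsifyReduced-unreduced {α} (kept-unreduced {l} keep))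

  URclause-sound : ∀ C → Valid C → Valid (URclause P C)
  URclause-sound C valid α with tautological C in taut
  ... | true = valid α
  ... | false with find (valid (falsifyReduced C α))
  ...   | l , l∈ , sat with urKeep P C l in keep
  ...     | true  =
    lose (∈-filterᵇ⁺ l∈ keep) (trans (sym (falsifyReduced-preserves-kept C {α} l∈ keep)) sat)
  ...     | false = ⊥-elim (not-¬ sat (begin
    value P (falsifyReduced C α) t (var l) ≡⟨ value-nonExist P {t} {falsifyReduced C α} isUniversal ⟩
    falsifyReduced C α (var l)             ≡⟨ falsifyReduced-reduced C taut {α} l∈ keep ⟩
    not (proj₁ l)                          ∎))
    where
      open ≡-Reasoning
      isUniversal : isExist P (var l) ≡ false
      isUniversal = ∈univ⇒¬isExist disj (Equivalence.to memV⇔∈ (reduced-isUniv C {l} keep))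

  valid-clauses : ∀ {ψ} → IsSkolem P ψ t → All Valid ψ
  valid-clauses sk = All.tabulate λ C∈ α → All.lookup (sk α) C∈

  skolem-of-valid : ∀ {ψ} → All Valid ψ → IsSkolem P ψ t
  skolem-of-valid valid α = All.map (λ v → v α) valid

  ∈-unitOf⇒singleton : ∀ {l} C → l ∈ unitOf P C → C ≡ l ∷ []
  ∈-unitOf⇒singleton (k ∷ []) l∈ with isExist P (var k) | l∈
  ... | true | here refl = refl

  unitLits-forced : ∀ ψ → IsSkolem P ψ t → ∀ {l} → l ∈ unitLits P ψ → Forced l
  unitLits-forced ψ sk l∈ α with find (∈-concatMap⁻ (unitOf P) {xs = ψ} l∈)
  ... | C , C∈ , l∈C with ∈-unitOf⇒singleton C l∈C
  ... | refl with All.lookup (sk α) C∈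
  ... | here sat = sat

  removeRefuted-valid : ∀ U → (∀ {u} → u ∈ U → Forced u) →
    ∀ C → Valid C → Valid (filterᵇ (λ l → not (memL l (map neg U))) C)
  removeRefuted-valid U forced C valid α with find (valid α)
  ... | l , l∈ , sat with memL l (map neg U) in refuted
  ... | false = lose (∈-filterᵇ⁺ l∈ (cong not refuted)) sat
  ... | true with ∈-map⁻ neg (Equivalence.to (memL⇔∈ {l}) refuted)
  ...   | u , u∈ , refl = ⊥-elim (not-¬ (forced u∈ α) sat)

  UP1-sound : ∀ ψ → IsSkolem P ψ t → IsSkolem P (UP1 P ψ) t
  UP1-sound ψ sk = skolem-of-valid (All.map⁺ (All.map⁺ (All.filter⁺ _ (All.map
    (λ {C} → URclause-sound _ ∘ removeRefuted-valid (unitLits P ψ) (unitLits-forced ψ sk) C)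
    (valid-clauses sk)))))

  UPiter-sound : ∀ k ψ → IsSkolem P ψ t → IsSkolem P (UPiter P k ψ) t
  UPiter-sound zero    ψ sk = sk
  UPiter-sound (suc k) ψ sk = UP1-sound (UPiter P k ψ) (UPiter-sound k ψ sk)

  UPiter-no-empty : ∀ k ψ → IsSkolem P ψ t → [] ∉ UPiter P k ψ
  UPiter-no-empty k ψ sk []∈ with All.lookup (UPiter-sound k ψ sk (λ _ → false)) []∈
  ... | ()

  UPunits-forced : ∀ k ψ → IsSkolem P ψ t → ∀ {l} → l ∈ UPunits P k ψ → Forced l
  UPunits-forced (suc k) ψ sk l∈ with ∈-++⁻ (UPunits P k ψ) l∈
  ... | inj₁ l∈earlier = UPunits-forced k ψ sk l∈earlier
  ... | inj₂ l∈round   = unitLits-forced (UPiter P k ψ) (UPiter-sound k ψ sk) l∈round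

override : List Var → (Var → Bool) → (Var → Bool) → Var → Bool
override V' α₀ β x = if memV x V' then α₀ x else β x

-- In abs(Π, V') each v ∈ V' is an existential with no dependencies: it is given the constant α₀ v.
abstractSkolem : List Var → (Var → Bool) → SkolemCandidate → SkolemCandidate
abstractSkolem V' α₀ s y β = if memV y V' then α₀ y else s y (override V' α₀ β)

override-inside : ∀ {V' α₀ β x} → x ∈ V' → override V' α₀ β x ≡ α₀ x
override-inside x∈ rewrite Equivalence.from memV⇔∈ x∈ = refl

override-self : ∀ V' α x → override V' α α x ≡ α x
override-self V' α x with memV x V'
... | true  = refl
... | false = refl

value-override-self : ∀ P V' {s α} v → RespectsDeps P s → value P (override V' α α) s v ≡ value P α s v
value-override-self P V' {α = α} v resp =
  value-cong P v resp (λ x _ → override-self V' α x) (λ _ → override-self V' α v)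

value-override-dep : ∀ P {V' s α₀ β} v → RespectsDeps P s →
  v ∈ univ P ⊎ v ∈ existVars P → dep P v ⊆ V' →
  value P (override V' α₀ β) s v ≡ value P α₀ s v
value-override-dep P {V'} {α₀ = α₀} {β} v resp declared dep⊆ = value-cong P v resp
  (λ x x∈ → override-inside {V'} {α₀} {β} (dep⊆ (depsOf⊆dep P x∈)))
  λ ¬ex → [ (λ v∈univ → override-inside {V'} {α₀} {β}
                           (dep⊆ (univ∈dep P ¬ex (Equivalence.from memV⇔∈ v∈univ))))
          , (λ v∈exist → ⊥-elim (not-¬ (∈existVars⇒isExist P v∈exist) ¬ex)) ]′ declared

module Abstraction (P : Prefix) (V' : List Var) (disj : QuantifiersDisjoint P) (V'⊆univ : V' ⊆ univ P) where

  P' : Prefix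
  P' = absPrefix P V'

  inside⇒¬isExist : ∀ {v} → memV v V' ≡ true → isExist P v ≡ false
  inside⇒¬isExist inV' = ∈univ⇒¬isExist disj (V'⊆univ (Equivalence.to memV⇔∈ inV'))

  absPrefix-disjoint : QuantifiersDisjoint P'
  absPrefix-disjoint v v∈univ v∈exist with ∈-filterᵇ⁻ (univ P) v∈univ
  ... | v∈univP , outV' = disj v v∈univP (isExist⇒∈existVars P (begin
    isExist P v  ≡⟨ isExist-absPrefix-outside P {V'} {v} (not-injective outV') ⟨
    isExist P' v ≡⟨ ∈existVars⇒isExist P' v∈exist ⟩
    true         ∎))
    where open ≡-Reasoning

  module _ (α₀ : Var → Bool) (s : SkolemCandidate) where

    value-abstractSkolem : ∀ β v →
      value P' β (abstractSkolem V' α₀ s) v ≡ value P (override V' α₀ β) s v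
    value-abstractSkolem β v with memV v V' in inV'
    ... | true  rewrite isExist-absPrefix-inside P {V'} {v} inV' | inside⇒¬isExist {v} inV' = refl
    ... | false rewrite isExist-absPrefix-outside P {V'} {v} inV' = refl

    abstractSkolem-respects : RespectsDeps P s → RespectsDeps P' (abstractSkolem V' α₀ s)
    abstractSkolem-respects resp =
      All.++⁺ (All.map⁺ (All.tabulate constant)) (All.map⁺ (All.tabulate restricted))
      where
        constant : ∀ {v} → v ∈ V' → ∀ β γ → (∀ x → x ∈ [] → β x ≡ γ x) →
          abstractSkolem V' α₀ s v β ≡ abstractSkolem V' α₀ s v γ
        constant v∈ β γ _ rewrite Equivalence.from memV⇔∈ v∈ = refl

        restricted : ∀ {yD} → yD ∈ exist P → ∀ β γ →
          (∀ x → x ∈ filterᵇ (λ x → not (memV x V')) (proj₂ yD) → β x ≡ γ x) →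
          abstractSkolem V' α₀ s (proj₁ yD) β ≡ abstractSkolem V' α₀ s (proj₁ yD) γ
        restricted {y , D} yD∈ β γ agree
          rewrite ¬-not {memV y V'} λ inV' →
                    disj y (V'⊆univ (Equivalence.to memV⇔∈ inV')) (∈-map⁺ proj₁ yD∈)
          = All.lookup resp yD∈ _ _ overrides-agree
          where
            overrides-agree : ∀ x → x ∈ D → override V' α₀ β x ≡ override V' α₀ γ x
            overrides-agree x x∈ with memV x V' in inV'
            ... | true  = refl
            ... | false = agree x (∈-filterᵇ⁺ x∈ (cong not inV'))

  module Propagation (α₀ : Var → Bool) {s : SkolemCandidate} (resp : RespectsDeps P s) =
    PropagationSoundness P' (abstractSkolem V' α₀ s) absPrefix-disjoint (abstractSkolem-respects α₀ s resp)

module AbstractionEntailment (Π : Prefix) (φ : CNF) (C' : Clause)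
         (disj : QuantifiersDisjoint Π) (deps⊆univ : DepsUniversal Π)
         (declared : All (λ l → var l ∈ univ Π ⊎ var l ∈ existVars Π) C') where

  private
    V' : List Var
    V' = depClause Π C'

    ψ : CNF
    ψ = andNegClause φ C'

  open Abstraction Π V' disj (depClause⊆univ Π deps⊆univ C')

  falsified⇒abstraction-Skolem : ∀ {s α₀} → RespectsDeps Π s → IsSkolem Π φ s →
    ¬ Satisfies Π s α₀ C' → IsSkolem P' ψ (abstractSkolem V' α₀ s)
  falsified⇒abstraction-Skolem {s} {α₀} resp sk C'-false β = All.++⁺
    (All.map⁺ (All.tabulate negated))
    (All.map (Any.map (trans (value-abstractSkolem α₀ s β _))) (sk (override V' α₀ β)))
    where
      negated : ∀ {k} → k ∈ C' → Satisfies P' (abstractSkolem V' α₀ s) β (neg k ∷ [])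
      negated {k} k∈ = here (begin
        value P' β (abstractSkolem V' α₀ s) (var k) ≡⟨ value-abstractSkolem α₀ s β (var k) ⟩
        value Π (override V' α₀ β) s (var k)        ≡⟨ value-override-dep Π (var k) resp (All.lookup declared k∈)
                                                         (∈-concatMap⁺ _ ∘ lose k∈) ⟩
        value Π α₀ s (var k)                        ≡⟨ ¬-not (C'-false ∘ lose k∈) ⟩
        not (proj₁ k)                               ∎)
        where open ≡-Reasoning

  satisfied-or-abstraction-Skolem : ∀ {s} → RespectsDeps Π s → IsSkolem Π φ s → ∀ α →
    Satisfies Π s α C' ⊎ IsSkolem P' ψ (abstractSkolem V' α s)
  satisfied-or-abstraction-Skolem {s} resp sk α with Any.any? (λ l → value Π α s (var l) ≟ proj₁ l) C'
  ... | yes sat   = inj₁ sat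
  ... | no  unsat = inj₂ (falsified⇒abstraction-Skolem resp sk unsat)

  refutation⇒entails : (P' , ψ) ⊢1∀⊥ → Entails Π φ C'
  refutation⇒entails (k , _ , []∈) s resp sk α =
    [ id , refuted ]′ (satisfied-or-abstraction-Skolem resp sk α)
    where
      refuted : IsSkolem P' ψ (abstractSkolem V' α s) → Satisfies Π s α C'
      refuted sk′ = ⊥-elim (Propagation.UPiter-no-empty α resp k ψ sk′ []∈)

  unit⇒entails : ∀ {U ℓ} → (P' , ψ) ⊢1∀ U → ℓ ∈ U → Entails Π φ (ℓ ∷ C')
  unit⇒entails {ℓ = ℓ} (k , _ , _ , refl) ℓ∈U s resp sk α =
    [ there , here ∘ forced ]′ (satisfied-or-abstraction-Skolem resp sk α)
    where
      forced : IsSkolem P' ψ (abstractSkolem V' α s) → value Π α s (var ℓ) ≡ proj₁ ℓ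
      forced sk′ = begin
        value Π α s (var ℓ)                        ≡⟨ value-override-self Π V' (var ℓ) resp ⟨
        value Π (override V' α α) s (var ℓ)        ≡⟨ value-abstractSkolem α s α (var ℓ) ⟨
        value P' α (abstractSkolem V' α s) (var ℓ) ≡⟨ Propagation.UPunits-forced α resp k ψ sk′ ℓ∈U α ⟩
        proj₁ ℓ                                    ∎
        where open ≡-Reasoning

mainTheorem2 : (Π : Prefix) (φ : CNF) (C C' : Clause) →
    WellFormed Π (andClause φ C) →
    C' ⊂ C →
    ((absPrefix Π (depClause Π C') , andNegClause φ C') ⊢1∀⊥ →
      (Π , andClause φ C) ≡DQBF (Π , andClause φ C'))
    × (∀ (U : List Literal) (ℓ : Literal) →
      (absPrefix Π (depClause Π C') , andNegClause φ C') ⊢1∀ U →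
      ℓ ∈ U → ℓ ∈ C → ℓ ∉ C' →
      (Π , andClause φ C) ≡DQBF (Π , andClause φ (ℓ ∷ C')))
mainTheorem2 Π φ C C' (_ , _ , disj , deps⊆univ , C-declared ∷ _) (C'⊆C , _) =
  (λ refuted → entailed-subclause-≡DQBF {Π} C'⊆C′ (refutation⇒entails refuted))
  , λ U ℓ derived ℓ∈U ℓ∈C _ → entailed-subclause-≡DQBF {Π} (ℓ∷C'⊆C ℓ∈C) (unit⇒entails derived ℓ∈U)
  where
    C'⊆C′ : C' ⊆ C
    C'⊆C′ = C'⊆C _

    C'-declared : All (λ l → var l ∈ univ Π ⊎ var l ∈ existVars Π) C'
    C'-declared = All.tabulate (All.lookup C-declared ∘ C'⊆C′)

    open AbstractionEntailment Π φ C' disj deps⊆univ C'-declared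

    ℓ∷C'⊆C : ∀ {ℓ} → ℓ ∈ C → ℓ ∷ C' ⊆ C
    ℓ∷C'⊆C ℓ∈C (here refl) = ℓ∈C
    ℓ∷C'⊆C _   (there l∈)  = C'⊆C′ l∈
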